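{- For $n\geq 1$, $$\sum_{\sigma\in\mathcal{Q}_n^2}q^{{\rm cyc}(\sigma)}=q(q+2)\cdots(q+2n-2).$$
   Context: Let $[n]_2=\{1,1,\ldots,n,n\}$. A Stirling permutation of order $k$ is a permutation of $[k]_2$ such that for each $i$ every entry between the two occurrences of $i$ is greater than $i$; $\mathcal{Q}_k$ denotes their set. For a word $\omega$, ${\rm red}(\omega)$ replaces each occurrence of the $i$th smallest distinct value by $i$. A Stirling permutation of the second kind of order $n$ is a permutation $\sigma$ of $[n]_2$ written as a nonempty disjoint union of cycles in standard cycle form such that: (i) the two copies of each $i\in[n]$ lie in the same cycle; (ii) each cycle is written with one of its smallest entries first and cycles are in increasing order of smallest entries; (iii) for each cycle $(c_1,\ldots,c_{2k})$, ${\rm red}(c_1\cdots c_{2k})\in\mathcal{Q}_k$. $\mathcal{Q}_n^2$ is the set of these, and ${\rm cyc}(\sigma)$ is the number of cycles of $\sigma$. -}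

module Defs where

open import Data.Nat using (ℕ; zero; suc; _+_; _*_; _^_; _≤_; _<_)
open import Data.Nat.Properties using (_≟_; _<?_)
open import Data.Fin using (Fin) renaming (_<_ to _<ᶠ_)
open import Data.List using (List; []; _∷_; length; map; concat; filter; deduplicate; lookup; upTo; mapMaybe; head)
open import Data.List.Membership.Propositional using (_∈_)
open import Data.List.Relation.Unary.All using (All)
open import Data.List.Relation.Unary.Linked using (Linked)
open import Data.List.Relation.Binary.Permutation.Propositional using (_↭_)
open import Data.Nat.ListAction using (sum; product)
open import Data.Product using (Σ; _×_)
open import Data.Empty using (⊥)
open import Relation.Binary.PropositionalEquality using (_≡_; _≢_)

doubled : ℕ → List ℕ
doubled zero    = []
doubled (suc n) = doubled n Data.List.++ (suc n ∷ suc n ∷ [])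

-- red(ω): replace each entry by the rank (starting at 1) of its value
-- among the distinct values of ω
red : List ℕ → List ℕ
red w = map (λ x → suc (length (deduplicate _≟_ (filter (_<? x) w)))) w

StirlingCond : List ℕ → Set
StirlingCond w = (a b c : Fin (length w)) → a <ᶠ b → b <ᶠ c →
  lookup w a ≡ lookup w c → lookup w a < lookup w b

IsStirlingPerm : ℕ → List ℕ → Set
IsStirlingPerm k w = (w ↭ doubled k) × StirlingCond w

occ : ℕ → List ℕ → ℕ
occ y w = length (filter (y ≟_) w)

-- a single cycle (c_1 ... c_2k), written as a list, c_1 first
ValidCycle : List ℕ → Set
ValidCycle []       = ⊥
ValidCycle (x ∷ xs) =
  All (x ≤_) xs
  × ((y : ℕ) → y ∈ (x ∷ xs) → occ y (x ∷ xs) ≡ 2)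
  × Σ ℕ (λ k → IsStirlingPerm k (red (x ∷ xs)))

-- σ ∈ Q_n^2, σ given as its list of cycles in standard cycle form
IsStirling2 : ℕ → List (List ℕ) → Set
IsStirling2 n σ =
  (σ ≢ [])
  × (concat σ ↭ doubled n)
  × All ValidCycle σ
  × Linked _<_ (mapMaybe head σ)             -- (ii) cycles ordered by smallest entries

cyc : List (List ℕ) → ℕ
cyc σ = length σ

risingBy2 : ℕ → ℕ → ℕ
risingBy2 n q = product (map (λ i → q + 2 * i) (upTo n))

module Submission where

-- Every σ ∈ Q²_{m+1} arises in exactly one way from some τ ∈ Q²_m by one of
-- the following moves with the new largest letter n = m+1:
--   * append the cycle (n n) at the end, which adds one cycle, or
--   * insert the factor n n into a cycle of τ directly after one of its
--     2m entries, which keeps the number of cycles.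
-- Hence passing from Q²_m to Q²_{m+1} multiplies the generating function by q+2m.

open import Defs
open import Data.Nat using (ℕ; zero; suc; _+_; _*_; _^_; _≤_; _<_; z≤n; s≤s)
open import Data.Nat.Properties
open import Data.Nat.ListAction using (sum; product)
open import Data.Nat.ListAction.Properties using (sum-++; product-++; sum-↭)
open import Data.Nat.Solver using (module +-*-Solver)
open import Data.List using (List; []; _∷_; _++_; [_]; length; map; concat; concatMap; filter; deduplicate; mapMaybe; head; upTo; lookup)
open import Data.List.Properties using (map-++; length-map; length-++; concat-++; filter-accept; filter-reject; filter-all; filter-none; length-filter; map-cong-local; applyUpTo-∷ʳ; ∷-injectiveˡ; ∷-injectiveʳ)
open import Data.List.Membership.Propositional using (_∈_; _∉_; find)
open import Data.List.Membership.Propositional.Properties using (∈-∃++; ∈-++⁺ˡ; ∈-++⁺ʳ; ∈-++⁻; ∈-map⁺; ∈-map⁻; ∈-deduplicate⁻; ∈-deduplicate⁺; ∈-filter⁺; ∈-filter⁻; ∈-lookup; ∈-concat⁻′; ∈-concatMap⁺; ∈-concatMap⁻)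
open import Data.List.Membership.Propositional.Properties.WithK using (unique∧set⇒bag)
open import Data.List.Relation.Unary.All as All using (All; []; _∷_)
import Data.List.Relation.Unary.All.Properties as All
open import Data.List.Relation.Unary.Any as Any using (here; there)
open import Data.List.Relation.Unary.Any.Properties using (lookup-index)
open import Data.List.Relation.Unary.Linked as Linked using (Linked; [-])
open import Data.List.Relation.Unary.AllPairs using ([]; _∷_)
open import Data.List.Relation.Unary.Unique.Propositional using (Unique)
import Data.List.Relation.Unary.Unique.Propositional.Properties as Unique
open import Data.List.Relation.Unary.Unique.DecPropositional.Properties _≟_ using (deduplicate-!)
open import Data.List.Relation.Binary.Permutation.Propositional using (_↭_; prep; swap; ↭-refl; ↭-sym; ↭-trans)
open import Data.List.Relation.Binary.Permutation.Propositional.Properties using (↭-length; ∈-resp-↭; All-resp-↭; ++⁺ˡ; ++⁺ʳ; ++-comm; shifts; drop-∷; filter-↭; map⁺)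
open import Data.List.Relation.Binary.BagAndSetEquality using (∼bag⇒↭)
open import Data.Fin using (Fin; zero; suc) renaming (_<_ to _<ᶠ_)
open import Data.Product using (Σ; _×_; _,_; proj₁; proj₂)
open import Data.Sum using (_⊎_; inj₁; inj₂)
open import Data.Unit using (⊤; tt)
open import Data.Empty using (⊥; ⊥-elim)
open import Function.Base using (id)
open import Function.Bundles using (_⇔_; mk⇔; Equivalence)
open import Relation.Nullary using (¬_; yes; no; Dec; ¬?)
open import Relation.Unary using (Decidable)
open import Relation.Binary.PropositionalEquality using (_≡_; _≢_; refl; sym; trans; cong; cong₂; subst; module ≡-Reasoning)

unique-same-members⇒↭ : {A : Set} {xs ys : List A} → Unique xs → Unique ys →
  (∀ {z} → z ∈ xs → z ∈ ys) → (∀ {z} → z ∈ ys → z ∈ xs) → xs ↭ ys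
unique-same-members⇒↭ uxs uys to from = ∼bag⇒↭ (unique∧set⇒bag uxs uys (mk⇔ to from))

data Ins2 {A : Set} (a : A) : List A → List A → Set where
  ins-here  : ∀ w → Ins2 a w (a ∷ a ∷ w)
  ins-there : ∀ y {w w′} → Ins2 a w w′ → Ins2 a (y ∷ w) (y ∷ w′)

module _ {A : Set} {a : A} where

  ins-↭ : ∀ {w w′} → Ins2 a w w′ → w′ ↭ a ∷ a ∷ w
  ins-↭ (ins-here w) = ↭-refl
  ins-↭ (ins-there y p) =
    ↭-trans (prep y (ins-↭ p)) (↭-trans (swap y a ↭-refl) (prep a (swap y a ↭-refl)))

  ins-∈⁻ : ∀ {w w′ z} → Ins2 a w w′ → z ∈ w′ → z ≡ a ⊎ z ∈ w
  ins-∈⁻ p m with ∈-resp-↭ (ins-↭ p) m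
  ... | here z≡a         = inj₁ z≡a
  ... | there (here z≡a) = inj₁ z≡a
  ... | there (there m′) = inj₂ m′

  ins-∈⁺ : ∀ {w w′ z} → Ins2 a w w′ → z ∈ w → z ∈ w′
  ins-∈⁺ p m = ∈-resp-↭ (↭-sym (ins-↭ p)) (there (there m))

  ins-inserted : ∀ {w w′} → Ins2 a w w′ → a ∈ w′
  ins-inserted p = ∈-resp-↭ (↭-sym (ins-↭ p)) (here refl)

  ins-All⁻ : ∀ {P : A → Set} {w w′} → Ins2 a w w′ → All P w′ → All P w
  ins-All⁻ p ps with All-resp-↭ (ins-↭ p) ps
  ... | _ ∷ _ ∷ ps′ = ps′

  ins-All⁺ : ∀ {P : A → Set} {w w′} → Ins2 a w w′ → P a → All P w → All P w′
  ins-All⁺ p pa ps = All-resp-↭ (↭-sym (ins-↭ p)) (pa ∷ pa ∷ ps)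

  ins-map : ∀ {B : Set} (f : A → B) {w w′} → Ins2 a w w′ → Ins2 (f a) (map f w) (map f w′)
  ins-map f (ins-here w)    = ins-here (map f w)
  ins-map f (ins-there y p) = ins-there (f y) (ins-map f p)

  ins-filter : ∀ {P : A → Set} (P? : Decidable P) {w w′} → Ins2 a w w′ → ¬ P a →
               filter P? w′ ≡ filter P? w
  ins-filter P? (ins-here w) ¬Pa = trans (filter-reject P? ¬Pa) (filter-reject P? ¬Pa)
  ins-filter {P} P? (ins-there y {w} {w′} p) ¬Pa = cons-case (P? y)
    where
    cons-case : Dec (P y) → filter P? (y ∷ w′) ≡ filter P? (y ∷ w)
    cons-case (yes Py) = trans (filter-accept P? Py)
      (trans (cong (y ∷_) (ins-filter P? p ¬Pa)) (sym (filter-accept P? Py)))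
    cons-case (no ¬Py) = trans (filter-reject P? ¬Py)
      (trans (ins-filter P? p ¬Pa) (sym (filter-reject P? ¬Py)))

doubled-suc-↭ : ∀ k → doubled (suc k) ↭ suc k ∷ suc k ∷ doubled k
doubled-suc-↭ k = ++-comm (doubled k) (suc k ∷ suc k ∷ [])

doubled-≤ : ∀ k {z} → z ∈ doubled k → z ≤ k
doubled-≤ (suc k) m with ∈-resp-↭ (doubled-suc-↭ k) m
... | here refl         = ≤-refl
... | there (here refl) = ≤-refl
... | there (there m′)  = m≤n⇒m≤1+n (doubled-≤ k m′)

doubled-top : ∀ k → suc k ∈ doubled (suc k)
doubled-top k = ∈-resp-↭ (↭-sym (doubled-suc-↭ k)) (here refl)

length-doubled : ∀ k → length (doubled k) ≡ k + k
length-doubled zero    = refl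
length-doubled (suc k) = begin
  length (doubled (suc k))       ≡⟨ ↭-length (doubled-suc-↭ k) ⟩
  suc (suc (length (doubled k))) ≡⟨ cong (λ t → suc (suc t)) (length-doubled k) ⟩
  suc (suc (k + k))              ≡⟨ cong suc (sym (+-suc k k)) ⟩
  suc k + suc k                  ∎
  where open ≡-Reasoning

↭-doubled⇒≤ : ∀ {k w} → w ↭ doubled k → All (_≤ k) w
↭-doubled⇒≤ {k} p = All-resp-↭ (↭-sym p) (All.tabulate (doubled-≤ k))

occ-here : ∀ y w → occ y (y ∷ w) ≡ suc (occ y w)
occ-here y w = cong length (filter-accept (y ≟_) refl)

occ-there : ∀ {y x} w → y ≢ x → occ y (x ∷ w) ≡ occ y w
occ-there {y} w y≢x = cong length (filter-reject (y ≟_) y≢x)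

occ-↭ : ∀ y {w w′} → w ↭ w′ → occ y w ≡ occ y w′
occ-↭ y p = ↭-length (filter-↭ (y ≟_) p)

occ-∉ : ∀ {y w} → y ∉ w → occ y w ≡ 0
occ-∉ {y} {w} y∉w = cong length (filter-none (y ≟_) (All.tabulate λ m y≡z → y∉w (subst (_∈ w) (sym y≡z) m)))

∈⇒occ>0 : ∀ {y w} → y ∈ w → 0 < occ y w
∈⇒occ>0 {y} {w} m with filter (y ≟_) w | ∈-filter⁺ (y ≟_) m refl
... | _ ∷ _ | _ = s≤s z≤n

occ>0⇒∈ : ∀ {y} w → 0 < occ y w → y ∈ w
occ>0⇒∈ {y} w pos with filter (y ≟_) w in eq
... | z ∷ _ with ∈-filter⁻ (y ≟_) {xs = w} (subst (z ∈_) (sym eq) (here refl))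
...   | z∈w , y≡z = subst (_∈ w) (sym y≡z) z∈w

ins-occ-self : ∀ {a w w′} → Ins2 a w w′ → occ a w′ ≡ 2 + occ a w
ins-occ-self {a} {w} p = trans (occ-↭ a (ins-↭ p)) (trans (occ-here a (a ∷ w)) (cong suc (occ-here a w)))

ins-occ-other : ∀ {a w w′} y → y ≢ a → Ins2 a w w′ → occ y w′ ≡ occ y w
ins-occ-other {a} {w} y y≢a p = trans (occ-↭ y (ins-↭ p)) (trans (occ-there (a ∷ w) y≢a) (occ-there w y≢a))

Twice : List ℕ → Set
Twice w = (y : ℕ) → y ∈ w → occ y w ≡ 2

ins-fresh-Twice : ∀ {a w w′} → Ins2 a w w′ → a ∉ w → Twice w → Twice w′
ins-fresh-Twice {a} p a∉w twice y m with y ≟ a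
... | yes refl = trans (ins-occ-self p) (cong (λ t → suc (suc t)) (occ-∉ a∉w))
... | no y≢a with ins-∈⁻ p m
...   | inj₁ y≡a = ⊥-elim (y≢a y≡a)
...   | inj₂ m′  = trans (ins-occ-other y y≢a p) (twice y m′)

del-fresh-Twice : ∀ {a w w′} → Ins2 a w w′ → a ∉ w → Twice w′ → Twice w
del-fresh-Twice p a∉w twice y m =
  trans (sym (ins-occ-other y (λ { refl → a∉w m }) p)) (twice y (ins-∈⁺ p m))

Above : ℕ → List ℕ → Set
Above x []      = ⊤
Above x (y ∷ w) = (x ∈ w → x < y) × Above x w

Stirling : List ℕ → Set
Stirling []      = ⊤
Stirling (x ∷ w) = Above x w × Stirling w

Above-from-positions : ∀ x w →
  ((b c : Fin (length w)) → b <ᶠ c → x ≡ lookup w c → x < lookup w b) → Above x w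
Above-from-positions x []      h = tt
Above-from-positions x (y ∷ w) h =
  (λ m → h zero (suc (Any.index m)) (s≤s z≤n) (lookup-index m)) ,
  Above-from-positions x w (λ b c b<c eq → h (suc b) (suc c) (s≤s b<c) eq)

Above-at-positions : ∀ x w → Above x w →
  (b c : Fin (length w)) → b <ᶠ c → x ≡ lookup w c → x < lookup w b
Above-at-positions x (y ∷ w) (later , _) zero (suc c) _ eq = later (subst (_∈ w) (sym eq) (∈-lookup c))
Above-at-positions x (y ∷ w) (_ , above) (suc b) (suc c) (s≤s b<c) eq = Above-at-positions x w above b c b<c eq

StirlingCond⇒Stirling : ∀ w → StirlingCond w → Stirling w
StirlingCond⇒Stirling []      _  = tt
StirlingCond⇒Stirling (x ∷ w) sc =
  Above-from-positions x w (λ b c b<c eq → sc zero (suc b) (suc c) (s≤s z≤n) (s≤s b<c) eq) ,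
  StirlingCond⇒Stirling w (λ a b c a<b b<c eq → sc (suc a) (suc b) (suc c) (s≤s a<b) (s≤s b<c) eq)

Stirling⇒StirlingCond : ∀ w → Stirling w → StirlingCond w
Stirling⇒StirlingCond (x ∷ w) (above , _) zero (suc b) (suc c) _ (s≤s b<c) eq =
  Above-at-positions x w above b c b<c eq
Stirling⇒StirlingCond (x ∷ w) (_ , st) (suc a) (suc b) (suc c) (s≤s a<b) (s≤s b<c) eq =
  Stirling⇒StirlingCond w st a b c a<b b<c eq

Above-del : ∀ {a x w w′} → Ins2 a w w′ → Above x w′ → Above x w
Above-del (ins-here w)    (_ , _ , above)  = above
Above-del (ins-there y p) (later , above) = (λ m → later (ins-∈⁺ p m)) , Above-del p above

Stirling-del : ∀ {a w w′} → Ins2 a w w′ → Stirling w′ → Stirling w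
Stirling-del (ins-here w)    (_ , _ , st) = st
Stirling-del (ins-there y p) (above , st) = Above-del p above , Stirling-del p st

Above-absent : ∀ {x} w → x ∉ w → Above x w
Above-absent []      _   = tt
Above-absent (y ∷ w) x∉w = (λ m → ⊥-elim (x∉w (there m))) , Above-absent w (λ m → x∉w (there m))

Above-ins : ∀ {a x w w′} → Ins2 a w w′ → x < a → Above x w → Above x w′
Above-ins (ins-here w) x<a above = (λ _ → x<a) , (λ _ → x<a) , above
Above-ins {a} {x} (ins-there y {w} {w′} p) x<a (later , above) = later′ , Above-ins p x<a above
  where
  later′ : x ∈ w′ → x < y
  later′ m with ins-∈⁻ p m
  ... | inj₁ refl = ⊥-elim (<-irrefl refl x<a)
  ... | inj₂ m′   = later m′

below⇒∉ : ∀ {a w} → All (_< a) w → a ∉ w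
below⇒∉ below m = <-irrefl refl (All.lookup below m)

Stirling-ins-max : ∀ {a w w′} → Ins2 a w w′ → All (_< a) w → Stirling w → Stirling w′
Stirling-ins-max (ins-here w) below st =
  ((λ m → ⊥-elim (below⇒∉ below m)) , Above-absent w (below⇒∉ below)) , Above-absent w (below⇒∉ below) , st
Stirling-ins-max (ins-there y p) (y<a ∷ below) (above , st) = Above-ins p y<a above , Stirling-ins-max p below st

Stirling-reflect : (r : ℕ → ℕ) → (∀ {a b} → r a < r b → a < b) → ∀ w → Stirling (map r w) → Stirling w
Stirling-reflect r reflects []      _            = tt
Stirling-reflect r reflects (x ∷ w) (above , st) = Above-reflect w above , Stirling-reflect r reflects w st
  where
  Above-reflect : ∀ w → Above (r x) (map r w) → Above x w
  Above-reflect []      _               = tt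
  Above-reflect (y ∷ w) (later , above) = (λ m → reflects (later (∈-map⁺ r m))) , Above-reflect w above

distinct : List ℕ → ℕ
distinct w = length (deduplicate _≟_ w)

-- rank w x is one more than the number of distinct values of w below x,
-- so that red w = map (rank w) w.
rank : List ℕ → ℕ → ℕ
rank w x = suc (distinct (filter (_<? x) w))

rank-mono : ∀ w {y x} → y ≤ x → rank w y ≤ rank w x
rank-mono w {y} {x} y≤x =
  s≤s (≤-trans (≤-reflexive (↭-length below-y)) (length-filter (_<? y) (deduplicate _≟_ (filter (_<? x) w))))
  where
  below-y : deduplicate _≟_ (filter (_<? y) w) ↭ filter (_<? y) (deduplicate _≟_ (filter (_<? x) w))
  below-y = unique-same-members⇒↭ (deduplicate-! _) (Unique.filter⁺ (_<? y) (deduplicate-! (filter (_<? x) w)))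
    (λ m → let (z∈w , z<y) = ∈-filter⁻ (_<? y) {xs = w} (∈-deduplicate⁻ _≟_ _ m) in
       ∈-filter⁺ (_<? y) (∈-deduplicate⁺ _≟_ (∈-filter⁺ (_<? x) z∈w (<-≤-trans z<y y≤x))) z<y)
    (λ m → let (z∈d , z<y) = ∈-filter⁻ (_<? y) {xs = deduplicate _≟_ (filter (_<? x) w)} m in
       let (z∈w , _) = ∈-filter⁻ (_<? x) {xs = w} (∈-deduplicate⁻ _≟_ _ z∈d) in
       ∈-deduplicate⁺ _≟_ (∈-filter⁺ (_<? y) z∈w z<y))

rank-reflects-< : ∀ w {x y} → rank w x < rank w y → x < y
rank-reflects-< w {x} {y} lt with x <? y
... | yes x<y = x<y
... | no x≮y  = ⊥-elim (≤⇒≯ (rank-mono w (≮⇒≥ x≮y)) lt)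

distinct-ins : ∀ {a w w′} → Ins2 a w w′ → a ∉ w → distinct w′ ≡ suc (distinct w)
distinct-ins {a} {w} {w′} p a∉w = ↭-length (unique-same-members⇒↭ (deduplicate-! w′) (a∉dedup ∷ deduplicate-! w) to from)
  where
  a∉dedup : All (a ≢_) (deduplicate _≟_ w)
  a∉dedup = All.tabulate λ m a≡z → a∉w (subst (_∈ w) (sym a≡z) (∈-deduplicate⁻ _≟_ w m))
  to : ∀ {z} → z ∈ deduplicate _≟_ w′ → z ∈ a ∷ deduplicate _≟_ w
  to m with ins-∈⁻ p (∈-deduplicate⁻ _≟_ w′ m)
  ... | inj₁ z≡a = here z≡a
  ... | inj₂ z∈w = there (∈-deduplicate⁺ _≟_ z∈w)
  from : ∀ {z} → z ∈ a ∷ deduplicate _≟_ w → z ∈ deduplicate _≟_ w′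
  from (here refl) = ∈-deduplicate⁺ _≟_ (ins-inserted p)
  from (there m)   = ∈-deduplicate⁺ _≟_ (ins-∈⁺ p (∈-deduplicate⁻ _≟_ w m))

rank-ins : ∀ {a w w′} → Ins2 a w w′ → ∀ {y} → y ≤ a → rank w′ y ≡ rank w y
rank-ins p {y} y≤a = cong (λ v → suc (distinct v)) (ins-filter (_<? y) p (≤⇒≯ y≤a))

red-ins : ∀ {a w w′} → Ins2 a w w′ → All (_≤ a) w → Ins2 (rank w′ a) (red w) (red w′)
red-ins {a} {w} {w′} p bounded =
  subst (λ v → Ins2 (rank w′ a) v (red w′)) (map-cong-local (All.map (rank-ins p) bounded)) (ins-map (rank w′) p)

red-ins-max : ∀ {a w w′} → Ins2 a w w′ → All (_< a) w → Ins2 (suc (distinct w)) (red w) (red w′)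
red-ins-max {a} {w} {w′} p below = subst (λ r → Ins2 r (red w) (red w′)) top-rank (red-ins p (All.map <⇒≤ below))
  where
  top-rank : rank w′ a ≡ suc (distinct w)
  top-rank = trans (rank-ins p ≤-refl) (cong (λ v → suc (distinct v)) (filter-all (_<? a) below))

-- A cycle is 'Tight' if its reduction is [k]_2 for k its number of distinct
-- values.  This strengthens condition (iii) to an invariant of insertion.
Tight : List ℕ → Set
Tight c = red c ↭ doubled (distinct c)

cycle-ins-max : ∀ {a x w w′} → Ins2 a w w′ → All (_< a) (x ∷ w) → ValidCycle (x ∷ w) → Tight (x ∷ w) →
                ValidCycle (x ∷ w′) × Tight (x ∷ w′)
cycle-ins-max {a} {x} {w} {w′} p below@(x<a ∷ _) (x-least , twice , (_ , _ , sc)) tight =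
  (ins-All⁺ p (<⇒≤ x<a) x-least , ins-fresh-Twice p′ (below⇒∉ below) twice , (suc k , red′↭ , Stirling⇒StirlingCond _ st′)) ,
  subst (λ t → red (x ∷ w′) ↭ doubled t) (sym (distinct-ins p′ (below⇒∉ below))) red′↭
  where
  p′ : Ins2 a (x ∷ w) (x ∷ w′)
  p′ = ins-there x p
  k : ℕ
  k = distinct (x ∷ w)
  ins : Ins2 (suc k) (red (x ∷ w)) (red (x ∷ w′))
  ins = red-ins-max p′ below
  red′↭ : red (x ∷ w′) ↭ doubled (suc k)
  red′↭ = ↭-trans (ins-↭ ins) (↭-trans (prep (suc k) (prep (suc k) tight)) (↭-sym (doubled-suc-↭ k)))
  st′ : Stirling (red (x ∷ w′))
  st′ = Stirling-ins-max ins (All.map s≤s (↭-doubled⇒≤ tight)) (StirlingCond⇒Stirling _ sc)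

cycle-del-max : ∀ {a x w₀ w} → Ins2 a w₀ w → a ∉ x ∷ w₀ → All (_≤ a) (x ∷ w) → ValidCycle (x ∷ w) →
                ValidCycle (x ∷ w₀)
cycle-del-max {a} {x} {w₀} {w} p a∉ bounded (x-least , twice , (k , red↭ , sc)) =
  ins-All⁻ p x-least , del-fresh-Twice p′ a∉ twice , red-del k red↭
  where
  p′ : Ins2 a (x ∷ w₀) (x ∷ w)
  p′ = ins-there x p
  ins : Ins2 (rank (x ∷ w) a) (red (x ∷ w₀)) (red (x ∷ w))
  ins = red-ins p′ (ins-All⁻ p′ bounded)
  red-del : ∀ k → red (x ∷ w) ↭ doubled k → Σ ℕ (λ k → IsStirlingPerm k (red (x ∷ w₀)))
  red-del zero red↭ with ↭-length red↭
  ... | ()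
  red-del (suc k) red↭ = k , red₀↭ , Stirling⇒StirlingCond _ (Stirling-del ins (StirlingCond⇒Stirling _ sc))
    where
    -- a has the largest rank suc k, since every value suc k is the rank of some y ≤ a
    k≤rank : suc k ≤ rank (x ∷ w) a
    k≤rank with ∈-map⁻ (rank (x ∷ w)) (∈-resp-↭ (↭-sym red↭) (doubled-top k))
    ... | y , y∈c , refl = rank-mono (x ∷ w) (All.lookup bounded y∈c)
    rank≡ : rank (x ∷ w) a ≡ suc k
    rank≡ = ≤-antisym (doubled-≤ (suc k) (∈-resp-↭ red↭ (ins-inserted ins))) k≤rank
    red₀↭ : red (x ∷ w₀) ↭ doubled k
    red₀↭ = drop-∷ (drop-∷ (subst (λ r → r ∷ r ∷ red (x ∷ w₀) ↭ suc k ∷ suc k ∷ doubled k) rank≡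
              (↭-trans (↭-sym (ins-↭ ins)) (↭-trans red↭ (doubled-suc-↭ k)))))

cycle-Stirling : ∀ c → ValidCycle c → Stirling c
cycle-Stirling (x ∷ w) (_ , _ , (_ , _ , sc)) =
  Stirling-reflect (rank (x ∷ w)) (rank-reflects-< (x ∷ w)) (x ∷ w) (StirlingCond⇒Stirling _ sc)

pair-cycle : ∀ a → ValidCycle (a ∷ a ∷ []) × Tight (a ∷ a ∷ [])
pair-cycle a =
  (≤-refl ∷ [] , twice , (1 , red↭ , Stirling⇒StirlingCond _ st)) ,
  subst (red (a ∷ a ∷ []) ↭_) (cong doubled (sym one-value)) red↭
  where
  red≡ : red (a ∷ a ∷ []) ≡ 1 ∷ 1 ∷ []
  red≡ = cong (λ v → suc (distinct v) ∷ suc (distinct v) ∷ []) (filter-none (_<? a) (<-irrefl refl ∷ <-irrefl refl ∷ []))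
  red↭ : red (a ∷ a ∷ []) ↭ doubled 1
  red↭ = subst (_↭ doubled 1) (sym red≡) ↭-refl
  st : Stirling (red (a ∷ a ∷ []))
  st = subst Stirling (sym red≡) (((λ ()) , tt) , tt , tt)
  one-value : distinct (a ∷ a ∷ []) ≡ 1
  one-value = cong (λ v → suc (length v)) (filter-reject (λ z → ¬? (a ≟ z)) {xs = []} (λ a≢a → a≢a refl))
  twice : Twice (a ∷ a ∷ [])
  twice y (here refl)         = trans (occ-here a (a ∷ [])) (cong suc (occ-here a []))
  twice y (there (here refl)) = trans (occ-here a (a ∷ [])) (cong suc (occ-here a []))

System : ℕ → List (List ℕ) → Set
System n σ = (concat σ ↭ doubled n) × All ValidCycle σ × Linked _<_ (mapMaybe head σ)

TightSystem : ℕ → List (List ℕ) → Set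
TightSystem n σ = System n σ × All Tight σ

system-≤ : ∀ {n σ} → System n σ → All (All (_≤ n)) σ
system-≤ {n} {σ} (perm , _ , _) = All.concat⁻ {xss = σ} (↭-doubled⇒≤ perm)

system-< : ∀ {m σ} → System m σ → All (All (_< suc m)) σ
system-< sys = All.map (All.map s≤s) (system-≤ sys)

heads-++ : ∀ (σ τ : List (List ℕ)) → mapMaybe head (σ ++ τ) ≡ mapMaybe head σ ++ mapMaybe head τ
heads-++ []            τ = refl
heads-++ ([] ∷ σ)      τ = heads-++ σ τ
heads-++ ((y ∷ c) ∷ σ) τ = cong (y ∷_) (heads-++ σ τ)

heads-All : ∀ {P : ℕ → Set} {σ} → All (All P) σ → All P (mapMaybe head σ)
heads-All []                                  = []
heads-All {σ = [] ∷ σ}      (_ ∷ ps)        = heads-All ps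
heads-All {σ = (y ∷ c) ∷ σ} ((py ∷ _) ∷ ps) = py ∷ heads-All ps

linked-snoc : ∀ {n} xs → Linked _<_ xs → All (_< n) xs → Linked _<_ (xs ++ [ n ])
linked-snoc []           _                 _           = [-]
linked-snoc (x ∷ [])     _                 (x<n ∷ _)   = x<n Linked.∷ [-]
linked-snoc (x ∷ y ∷ xs) (x<y Linked.∷ lk) (_ ∷ below) = x<y Linked.∷ linked-snoc (y ∷ xs) lk below

linked-++ˡ : ∀ (xs : List ℕ) {ys} → Linked _<_ (xs ++ ys) → Linked _<_ xs
linked-++ˡ []           _                 = Linked.[]
linked-++ˡ (x ∷ [])     _                 = [-]
linked-++ˡ (x ∷ y ∷ xs) (x<y Linked.∷ lk) = x<y Linked.∷ linked-++ˡ (y ∷ xs) lk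

linked-++ʳ : ∀ (xs : List ℕ) {ys} → Linked _<_ (xs ++ ys) → Linked _<_ ys
linked-++ʳ []       lk = lk
linked-++ʳ (x ∷ xs) lk = linked-++ʳ xs (Linked.tail lk)

-- 'InsertInto a τ σ': σ arises from τ by inserting a a into one of its cycles
-- directly after some entry (never in front of the first entry).
data InsertInto (a : ℕ) : List (List ℕ) → List (List ℕ) → Set where
  into-here  : ∀ x {w w′} τ → Ins2 a w w′ → InsertInto a ((x ∷ w) ∷ τ) ((x ∷ w′) ∷ τ)
  into-there : ∀ c {τ σ} → InsertInto a τ σ → InsertInto a (c ∷ τ) (c ∷ σ)

into-concat : ∀ {a τ σ} → InsertInto a τ σ → concat σ ↭ a ∷ a ∷ concat τ
into-concat (into-here x τ p)    = ++⁺ʳ (concat τ) (ins-↭ (ins-there x p))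
into-concat {a} (into-there c r) = ↭-trans (++⁺ˡ c (into-concat r)) (shifts c (a ∷ a ∷ []))

into-heads : ∀ {a τ σ} → InsertInto a τ σ → mapMaybe head σ ≡ mapMaybe head τ
into-heads (into-here x τ p)      = refl
into-heads (into-there [] r)      = into-heads r
into-heads (into-there (y ∷ c) r) = cong (y ∷_) (into-heads r)

into-length : ∀ {a τ σ} → InsertInto a τ σ → length σ ≡ length τ
into-length (into-here x τ p) = refl
into-length (into-there c r)  = cong suc (into-length r)

into-prefix : ∀ {a} pre {c₀ c post} → InsertInto a (c₀ ∷ post) (c ∷ post) →
              InsertInto a (pre ++ c₀ ∷ post) (pre ++ c ∷ post)
into-prefix []        r = r
into-prefix (d ∷ pre) r = into-there d (into-prefix pre r)

into-valid : ∀ {a τ σ} → InsertInto a τ σ → All (All (_< a)) τ → All ValidCycle τ → All Tight τ →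
             All ValidCycle σ × All Tight σ
into-valid (into-here x τ p) (below ∷ _) (v ∷ vs) (t ∷ ts) =
  let (v′ , t′) = cycle-ins-max p below v t in (v′ ∷ vs) , (t′ ∷ ts)
into-valid (into-there c r) (_ ∷ belows) (v ∷ vs) (t ∷ ts) =
  let (vs′ , ts′) = into-valid r belows vs ts in (v ∷ vs′) , (t ∷ ts′)

insertions : {A : Set} → A → List A → List (List A)
insertions a []      = (a ∷ a ∷ []) ∷ []
insertions a (y ∷ w) = (a ∷ a ∷ y ∷ w) ∷ map (y ∷_) (insertions a w)

cycle-insertions : ℕ → List ℕ → List (List ℕ)
cycle-insertions a []      = []
cycle-insertions a (x ∷ w) = map (x ∷_) (insertions a w)

system-insertions : ℕ → List (List ℕ) → List (List (List ℕ))
system-insertions a []      = []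
system-insertions a (c ∷ τ) = map (_∷ τ) (cycle-insertions a c) ++ map (c ∷_) (system-insertions a τ)

extensions : ℕ → List (List ℕ) → List (List (List ℕ))
extensions n τ = (τ ++ [ n ∷ n ∷ [] ]) ∷ system-insertions n τ

enumeration : ℕ → List (List (List ℕ))
enumeration zero    = [] ∷ []
enumeration (suc m) = concatMap (extensions (suc m)) (enumeration m)

∈-insertions⇒Ins2 : {A : Set} (a : A) (w : List A) {w′ : List A} → w′ ∈ insertions a w → Ins2 a w w′
∈-insertions⇒Ins2 a []      (here refl) = ins-here []
∈-insertions⇒Ins2 a (y ∷ w) (here refl) = ins-here (y ∷ w)
∈-insertions⇒Ins2 a (y ∷ w) (there m) with ∈-map⁻ (y ∷_) m
... | _ , m′ , refl = ins-there y (∈-insertions⇒Ins2 a w m′)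

Ins2⇒∈-insertions : {A : Set} {a : A} {w w′ : List A} → Ins2 a w w′ → w′ ∈ insertions a w
Ins2⇒∈-insertions (ins-here [])      = here refl
Ins2⇒∈-insertions (ins-here (y ∷ w)) = here refl
Ins2⇒∈-insertions (ins-there y p)    = there (∈-map⁺ (y ∷_) (Ins2⇒∈-insertions p))

∈-system-insertions⇒InsertInto : ∀ a τ {σ} → σ ∈ system-insertions a τ → InsertInto a τ σ
∈-system-insertions⇒InsertInto a (c ∷ τ) m with ∈-++⁻ (map (_∷ τ) (cycle-insertions a c)) m
∈-system-insertions⇒InsertInto a ((x ∷ w) ∷ τ) m | inj₁ m₁ with ∈-map⁻ (_∷ τ) m₁
... | _ , m₂ , refl with ∈-map⁻ (x ∷_) m₂
... | _ , m₃ , refl = into-here x τ (∈-insertions⇒Ins2 a w m₃)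
∈-system-insertions⇒InsertInto a (c ∷ τ) m | inj₂ m₁ with ∈-map⁻ (c ∷_) m₁
... | _ , m₂ , refl = into-there c (∈-system-insertions⇒InsertInto a τ m₂)

InsertInto⇒∈-system-insertions : ∀ {a τ σ} → InsertInto a τ σ → σ ∈ system-insertions a τ
InsertInto⇒∈-system-insertions (into-here x τ p) =
  ∈-++⁺ˡ (∈-map⁺ (_∷ τ) (∈-map⁺ (x ∷_) (Ins2⇒∈-insertions p)))
InsertInto⇒∈-system-insertions {a} (into-there c {τ} r) =
  ∈-++⁺ʳ (map (_∷ τ) (cycle-insertions a c)) (∈-map⁺ (c ∷_) (InsertInto⇒∈-system-insertions r))

extension-sound : ∀ m τ {σ} → TightSystem m τ → σ ∈ extensions (suc m) τ → TightSystem (suc m) σ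
extension-sound m τ (sys@(perm , valid , linked) , tight) (here refl) =
  ( subst (_↭ doubled (suc m)) (concat-++ τ _) (++⁺ʳ (suc m ∷ suc m ∷ []) perm)
  , All.++⁺ valid (proj₁ (pair-cycle (suc m)) ∷ [])
  , subst (Linked _<_) (sym (heads-++ τ _)) (linked-snoc (mapMaybe head τ) linked (heads-All (system-< sys))))
  , All.++⁺ tight (proj₂ (pair-cycle (suc m)) ∷ [])
extension-sound m τ (sys@(perm , valid , linked) , tight) (there m′) =
  let r = ∈-system-insertions⇒InsertInto (suc m) τ m′
      (valid′ , tight′) = into-valid r (system-< sys) valid tight
  in ( ↭-trans (into-concat r) (↭-trans (prep (suc m) (prep (suc m) perm)) (↭-sym (doubled-suc-↭ m)))
     , valid′
     , subst (Linked _<_) (sym (into-heads r)) linked)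
     , tight′

enumeration-sound : ∀ m {σ} → σ ∈ enumeration m → TightSystem m σ
enumeration-sound zero    (here refl) = (↭-refl , [] , Linked.[]) , []
enumeration-sound (suc m) σ∈ with find (∈-concatMap⁻ (extensions (suc m)) {xs = enumeration m} σ∈)
... | τ , τ∈ , σ∈ext = extension-sound m τ (enumeration-sound m τ∈) σ∈ext

-- In a system of order n = m+1 the letter n lies in some cycle.
-- If that cycle starts with n it is (n n) and must be the last cycle; otherwise
-- the two copies of n are adjacent by the Stirling condition and can be deleted.

system-zero : ∀ {σ} → System 0 σ → σ ≡ []
system-zero {[]}          _                 = refl
system-zero {[] ∷ σ}      (_ , () ∷ _ , _)
system-zero {(x ∷ c) ∷ σ} (perm , _ , _)    with ↭-length perm
... | ()

constant-cycle : ∀ a w → All (a ≤_) w → All (_≤ a) w → occ a (a ∷ w) ≡ 2 → w ≡ a ∷ []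
constant-cycle a [] _ _ twice with trans (sym (occ-here a [])) twice
... | ()
constant-cycle a (y ∷ []) (a≤y ∷ _) (y≤a ∷ _) _ = cong (_∷ []) (≤-antisym y≤a a≤y)
constant-cycle a (y ∷ z ∷ w) (a≤y ∷ a≤z ∷ _) (y≤a ∷ z≤a ∷ _) twice
  with ≤-antisym y≤a a≤y | ≤-antisym z≤a a≤z
... | refl | refl with trans (sym (trans (occ-here a _) (cong suc (trans (occ-here a _) (cong suc (occ-here a _)))))) twice
... | ()

adjacent-copy : ∀ a w → occ a w ≡ 1 → Above a w → All (_≤ a) w → Σ (List ℕ) (λ w₀ → w ≡ a ∷ w₀ × a ∉ w₀)
adjacent-copy a (z ∷ w) once (later , _) (z≤a ∷ _) with z ≟ a
... | yes refl = w , refl , λ a∈w → <-irrefl (sym none) (∈⇒occ>0 a∈w)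
  where
  none : occ z w ≡ 0
  none = suc-injective (trans (sym (occ-here z w)) once)
... | no z≢a = ⊥-elim (≤⇒≯ z≤a (later (occ>0⇒∈ w (subst (0 <_) (sym a-once) (s≤s z≤n)))))
  where
  a-once : occ a w ≡ 1
  a-once = trans (sym (occ-there w (λ a≡z → z≢a (sym a≡z)))) once

find-pair : ∀ a w → a ∈ w → occ a w ≡ 2 → Stirling w → All (_≤ a) w →
            Σ (List ℕ) (λ w₀ → Ins2 a w₀ w × a ∉ w₀)
find-pair a (y ∷ w) a∈ twice (above , st) (_ ∷ bounded) with y ≟ a
... | yes refl with adjacent-copy y w (suc-injective (trans (sym (occ-here y w)) twice)) above bounded
...   | w₀ , refl , a∉w₀ = w₀ , ins-here w₀ , a∉w₀
find-pair a (y ∷ w) a∈ twice (above , st) (_ ∷ bounded) | no y≢a with a∈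
... | here a≡y = ⊥-elim (y≢a (sym a≡y))
... | there a∈w with find-pair a w a∈w (trans (sym (occ-there w (λ a≡y → y≢a (sym a≡y)))) twice) st bounded
...   | w₀ , p , a∉w₀ = y ∷ w₀ , ins-there y p , λ { (here a≡y) → y≢a (sym a≡y) ; (there a∈) → a∉w₀ a∈ }

pair-cycle-last : ∀ m pre post → System (suc m) (pre ++ (suc m ∷ suc m ∷ []) ∷ post) → post ≡ [] × System m pre
pair-cycle-last m pre [] (perm , valid , linked) =
  refl , (perm₀ , All.++⁻ˡ pre valid , linked-++ˡ (mapMaybe head pre) (subst (Linked _<_) (heads-++ pre _) linked))
  where
  perm₀ : concat pre ↭ doubled m
  perm₀ = drop-∷ (drop-∷ (↭-trans (++-comm (suc m ∷ suc m ∷ []) (concat pre))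
            (↭-trans (subst (_↭ doubled (suc m)) (sym (concat-++ pre _)) perm) (doubled-suc-↭ m))))
pair-cycle-last m pre (d ∷ post) sys@(_ , valid , linked) =
  ⊥-elim (not-after d (All.lookup valid d∈) (All.lookup (system-≤ sys) d∈) after)
  where
  d∈ : d ∈ pre ++ (suc m ∷ suc m ∷ []) ∷ d ∷ post
  d∈ = ∈-++⁺ʳ pre (there (here refl))
  after : Linked _<_ (suc m ∷ mapMaybe head (d ∷ post))
  after = linked-++ʳ (mapMaybe head pre) (subst (Linked _<_) (heads-++ pre _) linked)
  not-after : ∀ d → ValidCycle d → All (_≤ suc m) d → Linked _<_ (suc m ∷ mapMaybe head (d ∷ post)) → ⊥
  not-after (y ∷ _) _ (y≤n ∷ _) (n<y Linked.∷ _) = ≤⇒≯ y≤n n<y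

cycle-at : ∀ {n} pre {c} post → System n (pre ++ c ∷ post) → ValidCycle c × All (_≤ n) c
cycle-at pre {c} post sys@(_ , valid , _) = All.lookup valid c∈ , All.lookup (system-≤ sys) c∈
  where
  c∈ : c ∈ pre ++ c ∷ post
  c∈ = ∈-++⁺ʳ pre (here refl)

shrink-pair : ∀ m pre w post → System (suc m) (pre ++ (suc m ∷ w) ∷ post) →
  Σ (List (List ℕ)) (λ τ → System m τ × (pre ++ (suc m ∷ w) ∷ post) ∈ extensions (suc m) τ)
shrink-pair m pre w post sys with cycle-at pre post sys
... | (n-least , twice , _) , _ ∷ bounded with constant-cycle (suc m) w n-least bounded (twice (suc m) (here refl))
...   | refl with pair-cycle-last m pre post sys
...     | refl , sys₀ = pre , sys₀ , here refl

shrink-inside : ∀ m pre x w post → System (suc m) (pre ++ (x ∷ w) ∷ post) → suc m ∈ w →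
  Σ (List (List ℕ)) (λ τ → System m τ × (pre ++ (x ∷ w) ∷ post) ∈ extensions (suc m) τ)
shrink-inside m pre x w post sys n∈w with x ≟ suc m
... | yes refl = shrink-pair m pre w post sys
... | no x≢n with cycle-at pre post sys
...   | vc@(_ , twice , _) , bounded
      with find-pair (suc m) w n∈w (trans (sym (occ-there w λ n≡x → x≢n (sym n≡x))) (twice (suc m) (there n∈w)))
                     (proj₂ (cycle-Stirling (x ∷ w) vc)) (All.tail bounded)
...     | w₀ , p , n∉w₀ = τ , (perm₀ , valid₀ , subst (Linked _<_) (into-heads r) linked) , there (InsertInto⇒∈-system-insertions r)
  where
  τ : List (List ℕ)
  τ = pre ++ (x ∷ w₀) ∷ post
  r : InsertInto (suc m) τ (pre ++ (x ∷ w) ∷ post)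
  r = into-prefix pre (into-here x post p)
  perm₀ : concat τ ↭ doubled m
  perm₀ = drop-∷ (drop-∷ (↭-trans (↭-sym (into-concat r)) (↭-trans (proj₁ sys) (doubled-suc-↭ m))))
  linked : Linked _<_ (mapMaybe head (pre ++ (x ∷ w) ∷ post))
  linked = proj₂ (proj₂ sys)
  n∉ : suc m ∉ x ∷ w₀
  n∉ (here n≡x) = x≢n (sym n≡x)
  n∉ (there n∈) = n∉w₀ n∈
  valid₀ : All ValidCycle τ
  valid₀ = All.++⁺ (All.++⁻ˡ pre valid) (cycle-del-max p n∉ bounded vc ∷ All.tail (All.++⁻ʳ pre valid))
    where
    valid : All ValidCycle (pre ++ (x ∷ w) ∷ post)
    valid = proj₁ (proj₂ sys)

shrink : ∀ m σ → System (suc m) σ → Σ (List (List ℕ)) (λ τ → System m τ × σ ∈ extensions (suc m) τ)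
shrink m σ sys@(perm , _ , _) with ∈-concat⁻′ σ (∈-resp-↭ (↭-sym perm) (doubled-top m))
... | c , n∈c , c∈σ with ∈-∃++ c∈σ
... | pre , post , refl = shrink-at c n∈c sys
  where
  shrink-at : ∀ c → suc m ∈ c → System (suc m) (pre ++ c ∷ post) →
    Σ (List (List ℕ)) (λ τ → System m τ × (pre ++ c ∷ post) ∈ extensions (suc m) τ)
  shrink-at (x ∷ w) (here refl) sys = shrink-pair m pre w post sys
  shrink-at (x ∷ w) (there n∈w) sys = shrink-inside m pre x w post sys n∈w

enumeration-complete : ∀ m {σ} → System m σ → σ ∈ enumeration m
enumeration-complete zero    sys with system-zero sys
... | refl = here refl
enumeration-complete (suc m) {σ} sys with shrink m σ sys
... | τ , sys₀ , σ∈ext =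
  ∈-concatMap⁺ (extensions (suc m)) (Any.map (λ { refl → σ∈ext }) (enumeration-complete m sys₀))

-- Uniqueness.  Deleting the letter n undoes every move, and distinct moves
-- applied to the same system give distinct results.

delete-letter : ℕ → List ℕ → List ℕ
delete-letter a = filter (λ z → ¬? (a ≟ z))

cons-nonempty : List ℕ → List (List ℕ) → List (List ℕ)
cons-nonempty []      σ = σ
cons-nonempty (z ∷ c) σ = (z ∷ c) ∷ σ

delete : ℕ → List (List ℕ) → List (List ℕ)
delete a []      = []
delete a (c ∷ σ) = cons-nonempty (delete-letter a c) (delete a σ)

delete-absent : ∀ {a τ} → All (All (_< a)) τ → All ValidCycle τ → delete a τ ≡ τ
delete-absent [] [] = refl
delete-absent {a} {(x ∷ w) ∷ τ} (below ∷ belows) (_ ∷ valid) =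
  cong₂ cons-nonempty (filter-all (λ z → ¬? (a ≟ z)) (All.map (λ z<a a≡z → <-irrefl (sym a≡z) z<a) below))
                      (delete-absent belows valid)

delete-appended : ∀ a τ → delete a (τ ++ [ a ∷ a ∷ [] ]) ≡ delete a τ
delete-appended a [] = cong (λ c → cons-nonempty c []) (filter-none (λ z → ¬? (a ≟ z)) (a≡a ∷ a≡a ∷ []))
  where
  a≡a : ¬ ¬ a ≡ a
  a≡a a≢a = a≢a refl
delete-appended a (c ∷ τ) = cong (cons-nonempty (delete-letter a c)) (delete-appended a τ)

delete-into : ∀ {a τ σ} → InsertInto a τ σ → delete a σ ≡ delete a τ
delete-into {a} (into-here x τ p) =
  cong (λ c → cons-nonempty c (delete a τ)) (ins-filter (λ z → ¬? (a ≟ z)) (ins-there x p) (λ a≢a → a≢a refl))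
delete-into {a} (into-there c r)  = cong (cons-nonempty (delete-letter a c)) (delete-into r)

delete-extension : ∀ m τ {σ} → System m τ → σ ∈ extensions (suc m) τ → delete (suc m) σ ≡ τ
delete-extension m τ sys (here refl) =
  trans (delete-appended (suc m) τ) (delete-absent (system-< sys) (proj₁ (proj₂ sys)))
delete-extension m τ sys (there σ∈) =
  trans (delete-into (∈-system-insertions⇒InsertInto (suc m) τ σ∈)) (delete-absent (system-< sys) (proj₁ (proj₂ sys)))

unique-concatMap : {A B : Set} (f : A → List B) (g : B → A) {xs : List A} → Unique xs →
  (∀ {x} → x ∈ xs → Unique (f x)) → (∀ {x y} → x ∈ xs → y ∈ f x → g y ≡ x) → Unique (concatMap f xs)
unique-concatMap f g {[]}     _            _      _       = []
unique-concatMap f g {x ∷ xs} (x∉xs ∷ uxs) unique inverse =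
  Unique.++⁺ (unique (here refl)) (unique-concatMap f g uxs (λ m → unique (there m)) (λ m → inverse (there m))) disjoint
  where
  disjoint : ∀ {v} → ¬ (v ∈ f x × v ∈ concatMap f xs)
  disjoint (v∈fx , v∈rest) with find (∈-concatMap⁻ f {xs = xs} v∈rest)
  ... | x′ , x′∈xs , v∈fx′ = All.lookup x∉xs x′∈xs (trans (sym (inverse (here refl) v∈fx)) (inverse (there x′∈xs) v∈fx′))

insertions-unique : {A : Set} (a : A) (w : List A) → a ∉ w → Unique (insertions a w)
insertions-unique a []      _   = [] ∷ []
insertions-unique a (y ∷ w) a∉w = All.tabulate first-new ∷ Unique.map⁺ ∷-injectiveʳ (insertions-unique a w (λ m → a∉w (there m)))
  where
  -- the insertion at the front is the only one starting with a
  first-new : ∀ {v} → v ∈ map (y ∷_) (insertions a w) → (a ∷ a ∷ y ∷ w) ≢ v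
  first-new m eq with ∈-map⁻ (y ∷_) m
  ... | _ , _ , refl = a∉w (here (∷-injectiveˡ eq))

cycle-insertions-unique : ∀ a c → All (_< a) c → Unique (cycle-insertions a c)
cycle-insertions-unique a []      _           = []
cycle-insertions-unique a (x ∷ w) (_ ∷ below) = Unique.map⁺ ∷-injectiveʳ (insertions-unique a w (below⇒∉ below))

∈-cycle-insertions⇒∋ : ∀ a c {c′} → c′ ∈ cycle-insertions a c → a ∈ c′
∈-cycle-insertions⇒∋ a (x ∷ w) m with ∈-map⁻ (x ∷_) m
... | _ , m′ , refl = there (ins-inserted (∈-insertions⇒Ins2 a w m′))

system-insertions-unique : ∀ a τ → All (All (_< a)) τ → Unique (system-insertions a τ)
system-insertions-unique a []      _               = []
system-insertions-unique a (c ∷ τ) (below ∷ belows) =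
  Unique.++⁺ (Unique.map⁺ ∷-injectiveˡ (cycle-insertions-unique a c below))
             (Unique.map⁺ ∷-injectiveʳ (system-insertions-unique a τ belows)) disjoint
  where
  -- inserting into the first cycle changes it, inserting later keeps it
  disjoint : ∀ {v} → ¬ (v ∈ map (_∷ τ) (cycle-insertions a c) × v ∈ map (c ∷_) (system-insertions a τ))
  disjoint (m₁ , m₂) with ∈-map⁻ (_∷ τ) m₁
  ... | c′ , c′∈ , refl with ∈-map⁻ (c ∷_) m₂
  ... | _ , _ , eq = below⇒∉ below (subst (a ∈_) (∷-injectiveˡ eq) (∈-cycle-insertions⇒∋ a c c′∈))

-- Appending a cycle is distinguished from inserting by the number of cycles.
extensions-unique : ∀ a τ → All (All (_< a)) τ → Unique (extensions a τ)
extensions-unique a τ belows = All.tabulate appended-new ∷ system-insertions-unique a τ belows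
  where
  appended-new : ∀ {σ} → σ ∈ system-insertions a τ → (τ ++ [ a ∷ a ∷ [] ]) ≢ σ
  appended-new {σ} σ∈ eq = m+1+n≢m (length τ) (begin
    length τ + 1                 ≡⟨ sym (length-++ τ) ⟩
    length (τ ++ [ a ∷ a ∷ [] ]) ≡⟨ cong length eq ⟩
    length σ                     ≡⟨ into-length (∈-system-insertions⇒InsertInto a τ σ∈) ⟩
    length τ                     ∎)
    where open ≡-Reasoning

enumeration-unique : ∀ m → Unique (enumeration m)
enumeration-unique zero    = [] ∷ []
enumeration-unique (suc m) =
  unique-concatMap (extensions (suc m)) (delete (suc m)) (enumeration-unique m)
    (λ τ∈ → extensions-unique (suc m) _ (system-< (proj₁ (enumeration-sound m τ∈))))
    (λ τ∈ σ∈ → delete-extension m _ (proj₁ (enumeration-sound m τ∈)) σ∈)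

-- Every move from τ appends a cycle (weight × q) or inserts into
-- one of the 2m gaps after an entry of τ (weight unchanged), so the total
-- weight of the extensions of τ is weight τ · (q + 2m).

sum-map-concatMap : {A B : Set} (w : B → ℕ) (f : A → List B) (xs : List A) →
  sum (map w (concatMap f xs)) ≡ sum (map (λ x → sum (map w (f x))) xs)
sum-map-concatMap w f []       = refl
sum-map-concatMap w f (x ∷ xs) =
  trans (cong sum (map-++ w (f x) (concatMap f xs)))
        (trans (sum-++ (map w (f x)) _) (cong (sum (map w (f x)) +_) (sum-map-concatMap w f xs)))

sum-map-*ʳ : {A : Set} (f : A → ℕ) (k : ℕ) (xs : List A) → sum (map (λ x → f x * k) xs) ≡ sum (map f xs) * k
sum-map-*ʳ f k []       = refl
sum-map-*ʳ f k (x ∷ xs) = trans (cong (f x * k +_) (sum-map-*ʳ f k xs)) (sym (*-distribʳ-+ k (f x) _))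

length-insertions : {A : Set} (a : A) (w : List A) → length (insertions a w) ≡ suc (length w)
length-insertions a []      = refl
length-insertions a (y ∷ w) = cong suc (trans (length-map (y ∷_) (insertions a w)) (length-insertions a w))

length-cycle-insertions : ∀ a c → length (cycle-insertions a c) ≡ length c
length-cycle-insertions a []      = refl
length-cycle-insertions a (x ∷ w) = trans (length-map (x ∷_) (insertions a w)) (length-insertions a w)

risingBy2-suc : ∀ m q → risingBy2 (suc m) q ≡ risingBy2 m q * (q + 2 * m)
risingBy2-suc m q = begin
  product (map factor (upTo (suc m)))            ≡⟨ cong (λ is → product (map factor is)) (sym (applyUpTo-∷ʳ id m)) ⟩
  product (map factor (upTo m ++ [ m ]))          ≡⟨ cong product (map-++ factor (upTo m) [ m ]) ⟩
  product (map factor (upTo m) ++ [ factor m ])   ≡⟨ product-++ (map factor (upTo m)) [ factor m ] ⟩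
  risingBy2 m q * (factor m * 1)                  ≡⟨ cong (risingBy2 m q *_) (*-identityʳ (factor m)) ⟩
  risingBy2 m q * (q + 2 * m)                     ∎
  where
  open ≡-Reasoning
  factor : ℕ → ℕ
  factor i = q + 2 * i

module Weight (q : ℕ) where
  open +-*-Solver

  weight : List (List ℕ) → ℕ
  weight σ = q ^ cyc σ

  total : List (List (List ℕ)) → ℕ
  total L = sum (map weight L)

  total-same-tail : ∀ τ (cs : List (List ℕ)) → total (map (_∷ τ) cs) ≡ length cs * q ^ suc (length τ)
  total-same-tail τ []       = refl
  total-same-tail τ (c ∷ cs) = cong (q ^ suc (length τ) +_) (total-same-tail τ cs)

  total-same-head : ∀ c (σs : List (List (List ℕ))) → total (map (c ∷_) σs) ≡ q * total σs
  total-same-head c []       = sym (*-zeroʳ q)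
  total-same-head c (σ ∷ σs) = trans (cong (q * q ^ length σ +_) (total-same-head c σs)) (sym (*-distribˡ-+ q _ _))

  total-system-insertions : ∀ a τ → total (system-insertions a τ) ≡ length (concat τ) * q ^ length τ
  total-system-insertions a []      = refl
  total-system-insertions a (c ∷ τ) = begin
    total (map (_∷ τ) (cycle-insertions a c) ++ map (c ∷_) (system-insertions a τ))
      ≡⟨ cong sum (map-++ weight (map (_∷ τ) (cycle-insertions a c)) _) ⟩
    sum (map weight (map (_∷ τ) (cycle-insertions a c)) ++ map weight (map (c ∷_) (system-insertions a τ)))
      ≡⟨ sum-++ (map weight (map (_∷ τ) (cycle-insertions a c))) _ ⟩
    total (map (_∷ τ) (cycle-insertions a c)) + total (map (c ∷_) (system-insertions a τ))
      ≡⟨ cong₂ _+_ (total-same-tail τ (cycle-insertions a c)) (total-same-head c (system-insertions a τ)) ⟩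
    length (cycle-insertions a c) * (q * t) + q * total (system-insertions a τ)
      ≡⟨ cong₂ (λ k s → k * (q * t) + q * s) (length-cycle-insertions a c) (total-system-insertions a τ) ⟩
    length c * (q * t) + q * (length (concat τ) * t)
      ≡⟨ solve 4 (λ k l q′ t′ → k :* (q′ :* t′) :+ q′ :* (l :* t′) := (k :+ l) :* (q′ :* t′)) refl (length c) (length (concat τ)) q t ⟩
    (length c + length (concat τ)) * (q * t)
      ≡⟨ cong (_* (q * t)) (sym (length-++ c)) ⟩
    length (c ++ concat τ) * (q * t) ∎
    where
    open ≡-Reasoning
    t : ℕ
    t = q ^ length τ

  total-extensions : ∀ m τ → length (concat τ) ≡ m + m → total (extensions (suc m) τ) ≡ weight τ * (q + 2 * m)
  total-extensions m τ entries = begin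
    q ^ length (τ ++ [ suc m ∷ suc m ∷ [] ]) + total (system-insertions (suc m) τ)
      ≡⟨ cong₂ _+_ (cong (q ^_) (trans (length-++ τ) (+-comm (length τ) 1))) (total-system-insertions (suc m) τ) ⟩
    q * t + length (concat τ) * t
      ≡⟨ cong (λ l → q * t + l * t) entries ⟩
    q * t + (m + m) * t
      ≡⟨ solve 3 (λ m′ t′ q′ → q′ :* t′ :+ (m′ :+ m′) :* t′ := t′ :* (q′ :+ con 2 :* m′)) refl m t q ⟩
    t * (q + 2 * m) ∎
    where
    open ≡-Reasoning
    t : ℕ
    t = q ^ length τ

  total-enumeration : ∀ m → total (enumeration m) ≡ risingBy2 m q
  total-enumeration zero    = refl
  total-enumeration (suc m) = begin
    total (concatMap (extensions (suc m)) (enumeration m))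
      ≡⟨ sum-map-concatMap weight (extensions (suc m)) (enumeration m) ⟩
    sum (map (λ τ → total (extensions (suc m) τ)) (enumeration m))
      ≡⟨ cong sum (map-cong-local (All.tabulate λ {τ} τ∈ → total-extensions m τ (entries τ∈))) ⟩
    sum (map (λ τ → weight τ * (q + 2 * m)) (enumeration m))
      ≡⟨ sum-map-*ʳ weight (q + 2 * m) (enumeration m) ⟩
    total (enumeration m) * (q + 2 * m)
      ≡⟨ cong (_* (q + 2 * m)) (total-enumeration m) ⟩
    risingBy2 m q * (q + 2 * m)
      ≡⟨ sym (risingBy2-suc m q) ⟩
    risingBy2 (suc m) q ∎
    where
    open ≡-Reasoning
    entries : ∀ {τ} → τ ∈ enumeration m → length (concat τ) ≡ m + m
    entries τ∈ = trans (↭-length (proj₁ (proj₁ (enumeration-sound m τ∈)))) (length-doubled m)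

system-nonempty : ∀ {m σ} → System (suc m) σ → σ ≢ []
system-nonempty {m} (perm , _) refl with trans (↭-length perm) (length-doubled (suc m))
... | ()

corollary11 : (n : ℕ) → 1 ≤ n →
    (L : List (List (List ℕ))) → Unique L →
    ((σ : List (List ℕ)) → (σ ∈ L) ⇔ IsStirling2 n σ) →
    (q : ℕ) → sum (map (λ σ → q ^ cyc σ) L) ≡ risingBy2 n q
corollary11 (suc m) _ L unique-L members q = begin
  sum (map (λ σ → q ^ cyc σ) L)    ≡⟨ sum-↭ (map⁺ weight L↭enumeration) ⟩
  total (enumeration (suc m))      ≡⟨ total-enumeration (suc m) ⟩
  risingBy2 (suc m) q              ∎
  where
  open ≡-Reasoning
  open Weight q
  L↭enumeration : L ↭ enumeration (suc m)
  L↭enumeration = unique-same-members⇒↭ unique-L (enumeration-unique (suc m))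
    (λ {σ} σ∈L → enumeration-complete (suc m) (proj₂ (Equivalence.to (members σ) σ∈L)))
    (λ {σ} σ∈E → let sys = proj₁ (enumeration-sound (suc m) σ∈E) in
                 Equivalence.from (members σ) (system-nonempty sys , sys))
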